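{- Let $\Gamma$ be a connected graph with maximum degree $\delta_1$, and write $A(\Gamma;x)=x^n\sum_{k\in\mathcal{K}}A_k(\Gamma)x^k$. Then $\Gamma$ is regular if and only if $A_{\delta_1}(\Gamma)=1$.
   Context: All graphs are finite and simple with at least one vertex. For $\Gamma=(V,E)$ of order $n$, a vertex $v$ and $X\subseteq V$, $\delta_X(v)$ is the number of neighbours of $v$ in $X$, $\bar S=V\setminus S$, and $\mathcal{K}=[-\delta_1,\delta_1]\cap\mathbb{Z}$. A nonempty $S\subseteq V$ is a defensive $k$-alliance if $\delta_S(v)\ge\delta_{\bar S}(v)+k$ for all $v\in S$; its exact index of alliance is $k_S=\max\{k\in\mathcal{K}: S \text{ is a defensive } k\text{ -alliance}\}$. The alliance polynomial is $A(\Gamma;x)=\sum_{S} x^{n+k_S}$, the sum over all nonempty $S\subseteq V$ with induced subgraph $\langle S\rangle$ connected; $A_k(\Gamma)$ is the number of such $S$ with $k_S=k$. -}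

module Defs where

open import Data.Nat using (ℕ; zero; suc; _⊔_)
open import Data.Bool using (Bool; true; false; _∧_)
open import Data.Fin using (Fin)
open import Data.Fin.Subset using (Subset; _∈_; ∁; Nonempty; ⊤)
open import Data.Vec using (lookup)
open import Data.List using (List; foldr; map; allFin; filter; length)
open import Data.Integer using (ℤ; +_; -_) renaming (_+_ to _+ℤ_; _≤_ to _≤ℤ_)
open import Data.Product using (_×_; Σ)
open import Relation.Binary.PropositionalEquality using (_≡_)
open import Relation.Nullary using (¬_)
open import Data.Bool.Properties using (T?)

record Graph (n : ℕ) : Set where
  field
    adj   : Fin n → Fin n → Bool
    sym   : ∀ u v → adj u v ≡ adj v u
    irrefl : ∀ v → adj v v ≡ false

open Graph public

inS : ∀ {n} → Subset n → Fin n → Bool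
inS S u = lookup S u

δ : ∀ {n} → Graph n → Subset n → Fin n → ℕ
δ Γ X v = length (filter (λ u → T? (adj Γ v u ∧ inS X u)) (allFin _))

deg : ∀ {n} → Graph n → Fin n → ℕ
deg Γ v = δ Γ ⊤ v

maxDeg : ∀ {n} → Graph n → ℕ
maxDeg Γ = foldr _⊔_ 0 (map (deg Γ) (allFin _))

Regular : ∀ {n} → Graph n → Set
Regular Γ = Σ ℕ λ r → ∀ v → deg Γ v ≡ r

data WalkIn {n} (Γ : Graph n) (S : Subset n) : Fin n → Fin n → Set where
  here : ∀ {v} → v ∈ S → WalkIn Γ S v v
  step : ∀ {u w v} → u ∈ S → adj Γ u w ≡ true → WalkIn Γ S w v → WalkIn Γ S u v

ConnectedSet : ∀ {n} → Graph n → Subset n → Set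
ConnectedSet Γ S = Nonempty S × (∀ u v → u ∈ S → v ∈ S → WalkIn Γ S u v)

Connected : ∀ {n} → Graph n → Set
Connected Γ = ConnectedSet Γ ⊤

InK : ∀ {n} → Graph n → ℤ → Set
InK Γ k = (- (+ maxDeg Γ)) ≤ℤ k × k ≤ℤ (+ maxDeg Γ)

DefensiveAlliance : ∀ {n} → Graph n → Subset n → ℤ → Set
DefensiveAlliance Γ S k =
  Nonempty S × (∀ v → v ∈ S → (+ δ Γ (∁ S) v) +ℤ k ≤ℤ + δ Γ S v)

ExactIndex : ∀ {n} → Graph n → Subset n → ℤ → Set
ExactIndex Γ S k =
  InK Γ k × DefensiveAlliance Γ S k ×
  (∀ k' → InK Γ k' → DefensiveAlliance Γ S k' → k' ≤ℤ k)

-- The sets counted by A_k(Γ): nonempty S with ⟨S⟩ connected and k_S = k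
CountedBy-A : ∀ {n} → Graph n → ℤ → Subset n → Set
CountedBy-A Γ k S = ConnectedSet Γ S × ExactIndex Γ S k

-- The heart of the proof is that a defensive δ₁-alliance S of a connected
-- graph must be the whole vertex set.  For v ∈ S, counting neighbours gives
-- δ_S(v) + δ_S̄(v) = δ(v) ≤ δ₁, while the alliance condition demands
-- δ_S̄(v) + δ₁ ≤ δ_S(v); together these force δ_S̄(v) = 0 and δ(v) = δ₁.
-- So S is closed under adjacency, hence (Γ connected, S nonempty) S = V,
-- and every vertex has degree δ₁.  Conversely, in a regular graph V itself
-- is a defensive δ₁-alliance, and δ₁ being the top of 𝒦 makes k_V = δ₁.
module Submission where

open import Defs hiding (sym)
open import Data.Nat using (ℕ; suc; _⊔_; _≤_; _+_; z≤n)
open import Data.Nat.Properties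
  using (+-suc; +-identityʳ; +-cancelˡ-≡; +-cancelʳ-≤; ≤-antisym; ≤-refl; ≤-reflexive; ≤-trans;
         m≤m+n; m≤n+m; m≤m⊔n; m≤n⊔m; ⊔-lub; n≤0⇒n≡0; module ≤-Reasoning)
open import Data.Integer using (+_; +≤+) renaming (_+_ to _+ℤ_; _≤_ to _≤ℤ_)
open import Data.Integer.Properties using (drop‿+≤+; neg-≤-pos)
open import Data.Bool using (Bool; true; false; _∧_; not; T)
open import Data.Bool.Properties using (∧-identityʳ)
open import Data.Unit using (tt)
open import Data.Fin using (Fin; zero)
open import Data.Fin.Subset using (Subset; _∈_; _∉_; ∁; ⊤; Nonempty)
open import Data.Fin.Subset.Properties using (∈⊤; ⊆-antisym; _∈?_; x∉p⇒x∈∁p)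
open import Data.Vec using (lookup)
open import Data.Vec.Properties using ([]=⇒lookup; lookup-map)
open import Data.List using (List; []; _∷_; foldr; map; allFin; filter; length)
open import Data.List.Properties using (filter-some)
open import Data.List.Relation.Unary.Any using (here; there)
open import Data.List.Membership.Propositional using (lose) renaming (_∈_ to _∈ₗ_)
open import Data.List.Membership.Propositional.Properties using (∈-allFin)
open import Data.Product using (∃!; _×_; _,_; proj₁; proj₂)
open import Relation.Binary.PropositionalEquality using (_≡_; refl; sym; trans; cong; subst; module ≡-Reasoning)
open import Relation.Nullary using (yes; no; contradiction)
open import Relation.Nullary.Decidable using (T?)
open import Function.Bundles using (_⇔_; mk⇔)

count : {A : Set} → (A → Bool) → List A → ℕ
count f xs = length (filter (λ u → T? (f u)) xs)

count-∧-split : {A : Set} (f g : A → Bool) (xs : List A) →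
  count (λ u → f u ∧ g u) xs + count (λ u → f u ∧ not (g u)) xs ≡ count f xs
count-∧-split f g [] = refl
count-∧-split f g (x ∷ xs) with f x | g x
... | true  | true  = cong suc (count-∧-split f g xs)
... | true  | false = trans (+-suc _ _) (cong suc (count-∧-split f g xs))
... | false | _     = count-∧-split f g xs

count-cong : {A : Set} {f g : A → Bool} → (∀ u → f u ≡ g u) → (xs : List A) →
  count f xs ≡ count g xs
count-cong f≗g [] = refl
count-cong {f = f} {g} f≗g (x ∷ xs) with f x | g x | f≗g x
... | true  | true  | _ = cong suc (count-cong f≗g xs)
... | false | false | _ = count-cong f≗g xs
... | true  | false | ()
... | false | true  | ()

count-pos : {A : Set} (f : A → Bool) {x : A} {xs : List A} →
  x ∈ₗ xs → f x ≡ true → 1 ≤ count f xs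
count-pos f x∈xs fx = filter-some (λ u → T? (f u)) (lose x∈xs (subst T (sym fx) tt))

δ-split : ∀ {n} (Γ : Graph n) (S : Subset n) (v : Fin n) →
  δ Γ S v + δ Γ (∁ S) v ≡ deg Γ v
δ-split Γ S v = begin
  δ Γ S v + δ Γ (∁ S) v
    ≡⟨ cong (λ c → δ Γ S v + c) (count-cong (λ u → cong (adj Γ v u ∧_) (lookup-map u not S)) (allFin _)) ⟩
  count (λ u → adj Γ v u ∧ inS S u) (allFin _) + count (λ u → adj Γ v u ∧ not (inS S u)) (allFin _)
    ≡⟨ count-∧-split (adj Γ v) (inS S) (allFin _) ⟩
  count (adj Γ v) (allFin _)
    ≡⟨ count-cong (λ u → sym (adj∧⊤ u)) (allFin _) ⟩
  deg Γ v ∎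
  where
    open ≡-Reasoning
    adj∧⊤ : ∀ u → adj Γ v u ∧ inS ⊤ u ≡ adj Γ v u
    adj∧⊤ u rewrite []=⇒lookup (∈⊤ {x = u}) = ∧-identityʳ (adj Γ v u)

δ-∁⊤ : ∀ {n} (Γ : Graph n) (v : Fin n) → δ Γ (∁ ⊤) v ≡ 0
δ-∁⊤ Γ v = +-cancelˡ-≡ (deg Γ v) _ _ (trans (δ-split Γ ⊤ v) (sym (+-identityʳ _)))

δ-∁-pos : ∀ {n} (Γ : Graph n) (S : Subset n) {v x : Fin n} →
  adj Γ v x ≡ true → x ∉ S → 1 ≤ δ Γ (∁ S) v
δ-∁-pos Γ S {v} {x} vx x∉S = count-pos (λ u → adj Γ v u ∧ inS (∁ S) u) (∈-allFin x)
  (subst (λ b → b ∧ inS (∁ S) x ≡ true) (sym vx) ([]=⇒lookup (x∉p⇒x∈∁p x∉S)))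

≤-max : {A : Set} (f : A → ℕ) {x : A} {xs : List A} → x ∈ₗ xs → f x ≤ foldr _⊔_ 0 (map f xs)
≤-max f (here refl) = m≤m⊔n _ _
≤-max f {xs = y ∷ _} (there x∈xs) =
  ≤-trans (≤-max f x∈xs) (m≤n⊔m (f y) _)

max-≤ : {A : Set} (f : A → ℕ) {b : ℕ} → (∀ x → f x ≤ b) → (xs : List A) → foldr _⊔_ 0 (map f xs) ≤ b
max-≤ f bound [] = z≤n
max-≤ f bound (x ∷ xs) = ⊔-lub (bound x) (max-≤ f bound xs)

deg≤maxDeg : ∀ {n} (Γ : Graph n) (v : Fin n) → deg Γ v ≤ maxDeg Γ
deg≤maxDeg Γ v = ≤-max (deg Γ) (∈-allFin v)

maxDeg≤regular : ∀ {n} (Γ : Graph n) {r : ℕ} → (∀ v → deg Γ v ≡ r) → maxDeg Γ ≤ r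
maxDeg≤regular Γ reg = max-≤ (deg Γ) (λ v → ≤-reflexive (reg v)) (allFin _)

-- Arithmetic core: if c + d ≤ s and s + c ≤ d then c = 0 and s + c = d.
-- (Read c = δ_S̄(v), s = δ_S(v), d = δ₁.)
squeeze : ∀ {c d s} → c + d ≤ s → s + c ≤ d → (c ≡ 0) × (s + c ≡ d)
squeeze {c} {d} {s} c+d≤s s+c≤d = c≡0 , ≤-antisym s+c≤d d≤s+c
  where
    open ≤-Reasoning
    c≡0 : c ≡ 0
    c≡0 = n≤0⇒n≡0 (+-cancelʳ-≤ d c 0 (begin
      c + d ≤⟨ c+d≤s ⟩
      s     ≤⟨ m≤m+n s c ⟩
      s + c ≤⟨ s+c≤d ⟩
      d     ∎))
    d≤s+c : d ≤ s + c
    d≤s+c = begin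
      d     ≤⟨ m≤n+m d c ⟩
      c + d ≤⟨ c+d≤s ⟩
      s     ≤⟨ m≤m+n s c ⟩
      s + c ∎

module _ {n : ℕ} (Γ : Graph n) where

  δ₁-alliance-member : ∀ {S} → DefensiveAlliance Γ S (+ maxDeg Γ) → ∀ {v} → v ∈ S →
    (δ Γ (∁ S) v ≡ 0) × (deg Γ v ≡ maxDeg Γ)
  δ₁-alliance-member {S} (_ , defends) {v} v∈S =
    subst (λ g → (δ Γ (∁ S) v ≡ 0) × (g ≡ maxDeg Γ)) (δ-split Γ S v)
      (squeeze (drop‿+≤+ (defends v v∈S))
               (subst (_≤ maxDeg Γ) (sym (δ-split Γ S v)) (deg≤maxDeg Γ v)))

  δ₁-alliance-closed : ∀ {S} → DefensiveAlliance Γ S (+ maxDeg Γ) →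
    ∀ {v x} → v ∈ S → adj Γ v x ≡ true → x ∈ S
  δ₁-alliance-closed {S} alliance v∈S vx with _ ∈? S
  ... | yes x∈S = x∈S
  ... | no  x∉S = contradiction (subst (1 ≤_) (proj₁ (δ₁-alliance-member alliance v∈S)) (δ-∁-pos Γ S vx x∉S))
                                (λ ())

  closed-walk : ∀ {S} → (∀ {v x} → v ∈ S → adj Γ v x ≡ true → x ∈ S) →
    ∀ {a b} → a ∈ S → WalkIn Γ ⊤ a b → b ∈ S
  closed-walk closed a∈S (here _)      = a∈S
  closed-walk closed a∈S (step _ ax w) = closed-walk closed (closed a∈S ax) w

  δ₁-alliance≡⊤ : Connected Γ → ∀ {S} → DefensiveAlliance Γ S (+ maxDeg Γ) → S ≡ ⊤
  δ₁-alliance≡⊤ (_ , walks) alliance@((v₀ , v₀∈S) , _) =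
    ⊆-antisym (λ _ → ∈⊤) (λ {x} _ → closed-walk (δ₁-alliance-closed alliance) v₀∈S (walks v₀ x ∈⊤ ∈⊤))

  -- δ₁ is the largest element of 𝒦, so a defensive δ₁-alliance has k_S = δ₁.
  δ₁-alliance-exact : ∀ {S} → DefensiveAlliance Γ S (+ maxDeg Γ) → ExactIndex Γ S (+ maxDeg Γ)
  δ₁-alliance-exact alliance = (neg-≤-pos , +≤+ ≤-refl) , alliance , λ _ k∈𝒦 _ → proj₂ k∈𝒦

  regular⇒⊤-δ₁-alliance : ∀ {r} → Nonempty (⊤ {n}) → (∀ v → deg Γ v ≡ r) →
    DefensiveAlliance Γ ⊤ (+ maxDeg Γ)
  regular⇒⊤-δ₁-alliance nonempty reg = nonempty , λ v _ →
    subst (λ c → + c +ℤ + maxDeg Γ ≤ℤ + deg Γ v) (sym (δ-∁⊤ Γ v))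
      (+≤+ (≤-trans (maxDeg≤regular Γ reg) (≤-reflexive (sym (reg v)))))

proposition2p6 : (m : ℕ) (Γ : Graph (suc m)) → Connected Γ →
    (Regular Γ ⇔ ∃! {A = Subset (suc m)} _≡_ (CountedBy-A Γ (+ maxDeg Γ)))
proposition2p6 m Γ conn = mk⇔ regular⇒unique unique⇒regular
  where
    regular⇒unique : Regular Γ → ∃! _≡_ (CountedBy-A Γ (+ maxDeg Γ))
    regular⇒unique (_ , reg) =
      ⊤ , (conn , δ₁-alliance-exact Γ (regular⇒⊤-δ₁-alliance Γ (zero , ∈⊤) reg)) ,
      λ (_ , (_ , alliance , _)) → sym (δ₁-alliance≡⊤ Γ conn alliance)

    unique⇒regular : ∃! _≡_ (CountedBy-A Γ (+ maxDeg Γ)) → Regular Γ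
    unique⇒regular (_ , (_ , (_ , alliance , _)) , _) = maxDeg Γ , λ v →
      proj₂ (δ₁-alliance-member Γ alliance (subst (v ∈_) (sym (δ₁-alliance≡⊤ Γ conn alliance)) ∈⊤))
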